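{- Let $h$ and $a$ be positive integers and let $k = a^2$. Then $\left((a-1)h+1\right)^2 \in \mathcal{R}_{\mathbf{Z}}(h,k)$.
   Context: For a nonempty set $A$ of integers and a positive integer $h$, $hA$ denotes the set of all sums of $h$ not necessarily distinct elements of $A$. The sumset size set is $\mathcal{R}_{\mathbf{Z}}(h,k) = \{ |hA| : A \subseteq \mathbf{Z},\ |A| = k \}$. -}

module Defs where

open import Data.Nat using (ℕ)
open import Data.Integer using (ℤ; 0ℤ) renaming (_+_ to _+ℤ_)
open import Data.List using (List; length; foldr)
open import Data.List.Membership.Propositional using (_∈_)
open import Data.List.Relation.Unary.All using (All)
open import Data.List.Relation.Unary.Unique.Propositional using (Unique)
open import Data.Product using (Σ; _×_; ∃)
open import Relation.Binary.PropositionalEquality using (_≡_)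
open import Function.Bundles using (_⇔_)

sumℤ : List ℤ → ℤ
sumℤ = foldr _+ℤ_ 0ℤ

-- A finite set of integers is represented by a duplicate-free list.
-- x ∈ hA : x is a sum of h (not necessarily distinct) elements of A,
-- i.e. x = sum of a list of length h all of whose entries lie in A.
_∈Sumset_⟨_⟩ : ℤ → ℕ → List ℤ → Set
x ∈Sumset h ⟨ A ⟩ = Σ (List ℤ) λ xs → length xs ≡ h × All (_∈ A) xs × sumℤ xs ≡ x

SumsetSize : ℕ → List ℤ → ℕ → Set
SumsetSize h A s = Σ (List ℤ) λ L → Unique L × length L ≡ s ×
  ((x : ℤ) → (x ∈ L) ⇔ (x ∈Sumset h ⟨ A ⟩))

_∈R[_,_] : ℕ → ℕ → ℕ → Set
s ∈R[ h , k ] = Σ (List ℤ) λ A → Unique A × length A ≡ k × SumsetSize h A s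

-- With b = a - 1 and M = bh + 1, take A = {i + jM : 0 ≤ i, j ≤ b}: these a² numbers are
-- distinct because b < M. A sum of h elements of A is u + vM with 0 ≤ u, v ≤ bh = M - 1,
-- and every such pair (u, v) occurs, so hA = {0, …, M² - 1}.
module Submission where

open import Defs
open import Data.Nat using (ℕ; zero; suc; _+_; _*_; _∸_; _^_; _⊓_; _≤_; _<_; z≤n; s≤s; NonZero; >-nonZero)
open import Data.Nat.Properties
open import Data.Nat.DivMod using (_%_; [m+kn]%n≡m%n; m<n⇒m%n≡m; m%n<n; m<n*o⇒m/o<n; m≡m%n+[m/n]*n)
open import Data.Nat.ListAction using (sum)
open import Data.Nat.Tactic.RingSolver using (solve-∀)
open import Data.Integer using () renaming (+_ to pos; _+_ to _+ℤ_)
open import Data.Integer.Properties using (+-injective)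
open import Data.Fin using (Fin; toℕ; fromℕ<)
open import Data.Fin.Properties using (toℕ<n; toℕ-fromℕ<; toℕ-injective)
open import Data.List using (List; []; _∷_; _++_; length; map; upTo; allFin; cartesianProductWith)
open import Data.List.Properties using (length-map; length-++; length-upTo; length-tabulate)
open import Data.List.Membership.Propositional using (_∈_)
open import Data.List.Membership.Propositional.Properties
  using (∈-map⁺; ∈-map⁻; ∈-upTo⁺; ∈-upTo⁻; ∈-allFin; ∈-cartesianProductWith⁺; ∈-cartesianProductWith⁻)
open import Data.List.Relation.Unary.All as All using (All; []; _∷_)
open import Data.List.Relation.Unary.All.Properties using (map⁺)
open import Data.List.Relation.Unary.Unique.Propositional using (Unique)
import Data.List.Relation.Unary.Unique.Propositional.Properties as Unique
open import Data.Product using (Σ; _×_; _,_)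
open import Relation.Binary.PropositionalEquality
open import Function.Base using (id)
open import Function.Bundles using (_⇔_; mk⇔)

length-cartesianProductWith : ∀ {A B C : Set} (f : A → B → C) xs ys →
  length (cartesianProductWith f xs ys) ≡ length xs * length ys
length-cartesianProductWith f []       ys = refl
length-cartesianProductWith f (x ∷ xs) ys = begin
  length (map (f x) ys ++ cartesianProductWith f xs ys)
    ≡⟨ length-++ (map (f x) ys) ⟩
  length (map (f x) ys) + length (cartesianProductWith f xs ys)
    ≡⟨ cong₂ _+_ (length-map (f x) ys) (length-cartesianProductWith f xs ys) ⟩
  length ys + length xs * length ys ∎
  where open ≡-Reasoning

sum≤length*bound : ∀ {c} ys → All (_≤ c) ys → sum ys ≤ length ys * c
sum≤length*bound []       []           = z≤n
sum≤length*bound (y ∷ ys) (y≤c ∷ ys≤c) = +-mono-≤ y≤c (sum≤length*bound ys ys≤c)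

sumℤ-map-pos : ∀ ys → sumℤ (map pos ys) ≡ pos (sum ys)
sumℤ-map-pos []       = refl
sumℤ-map-pos (y ∷ ys) = cong (pos y +ℤ_) (sumℤ-map-pos ys)

All-∈-map⁻ : ∀ {A B : Set} (f : A → B) {xs zs} → All (_∈ map f xs) zs →
  Σ (List A) λ ws → map f ws ≡ zs × All (_∈ xs) ws
All-∈-map⁻ f []           = [] , refl , []
All-∈-map⁻ f (z∈ ∷ zs∈) with ∈-map⁻ f z∈ | All-∈-map⁻ f zs∈
... | w , w∈ , refl | ws , refl , ws∈ = w ∷ ws , refl , w∈ ∷ ws∈

pos-sum∈Sumset : ∀ {h B} ys → length ys ≡ h → All (_∈ B) ys →
  pos (sum ys) ∈Sumset h ⟨ map pos B ⟩
pos-sum∈Sumset ys length≡h ys∈ = map pos ys , trans (length-map pos ys) length≡h ,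
  map⁺ (All.map (∈-map⁺ pos) ys∈) , sumℤ-map-pos ys

∈Sumset-map-pos⁻ : ∀ {h B x} → x ∈Sumset h ⟨ map pos B ⟩ →
  Σ (List ℕ) λ ys → length ys ≡ h × All (_∈ B) ys × x ≡ pos (sum ys)
∈Sumset-map-pos⁻ (xs , length≡h , xs∈ , sum≡x) with All-∈-map⁻ pos xs∈
... | ys , refl , ys∈ = ys , trans (sym (length-map pos ys)) length≡h , ys∈ ,
  trans (sym sum≡x) (sumℤ-map-pos ys)

digits-injective : ∀ M .{{_ : NonZero M}} {i j i′ j′} → i < M → i′ < M →
  i + j * M ≡ i′ + j′ * M → i ≡ i′ × j ≡ j′
digits-injective M {i} {j} {i′} {j′} i<M i′<M eq = i≡i′ , j≡j′
  where
  open ≡-Reasoning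
  i≡i′ : i ≡ i′
  i≡i′ = begin
    i                 ≡⟨ m<n⇒m%n≡m i<M ⟨
    i % M             ≡⟨ [m+kn]%n≡m%n i j M ⟨
    (i + j * M) % M   ≡⟨ cong (_% M) eq ⟩
    (i′ + j′ * M) % M ≡⟨ [m+kn]%n≡m%n i′ j′ M ⟩
    i′ % M            ≡⟨ m<n⇒m%n≡m i′<M ⟩
    i′                ∎
  j≡j′ : j ≡ j′
  j≡j′ = *-cancelʳ-≡ j j′ M (+-cancelˡ-≡ i _ _ (trans eq (cong (_+ j′ * M) (sym i≡i′))))

digit-sum : ∀ i j u v M → (i + j * M) + (u + v * M) ≡ (i + u) + (j + v) * M
digit-sum = solve-∀

module DigitGrid (b M : ℕ) where

  digit : Fin (suc b) → Fin (suc b) → ℕ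
  digit i j = toℕ i + toℕ j * M

  digitGrid : List ℕ
  digitGrid = cartesianProductWith digit (allFin (suc b)) (allFin (suc b))

  length-digitGrid : length digitGrid ≡ suc b * suc b
  length-digitGrid = begin
    length digitGrid
      ≡⟨ length-cartesianProductWith digit (allFin (suc b)) (allFin (suc b)) ⟩
    length (allFin (suc b)) * length (allFin (suc b))
      ≡⟨ cong₂ _*_ (length-tabulate {n = suc b} id) (length-tabulate {n = suc b} id) ⟩
    suc b * suc b ∎
    where open ≡-Reasoning

  digitGrid-unique : b < M → Unique digitGrid
  digitGrid-unique b<M =
    Unique.cartesianProductWith⁺ digit digit-injective (Unique.allFin⁺ _) (Unique.allFin⁺ _)
    where
    instance _ = >-nonZero (≤-<-trans z≤n b<M)
    toℕ<M : ∀ (i : Fin (suc b)) → toℕ i < M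
    toℕ<M i = ≤-trans (toℕ<n i) b<M
    digit-injective : ∀ {i i′ j j′} → digit i j ≡ digit i′ j′ → i ≡ i′ × j ≡ j′
    digit-injective {i} {i′} eq with digits-injective M (toℕ<M i) (toℕ<M i′) eq
    ... | i≡i′ , j≡j′ = toℕ-injective i≡i′ , toℕ-injective j≡j′

  ∈-digitGrid⁺ : ∀ {i j} → i ≤ b → j ≤ b → i + j * M ∈ digitGrid
  ∈-digitGrid⁺ i≤b j≤b = subst (_∈ digitGrid)
    (cong₂ (λ i j → i + j * M) (toℕ-fromℕ< (s≤s i≤b)) (toℕ-fromℕ< (s≤s j≤b)))
    (∈-cartesianProductWith⁺ digit (∈-allFin (fromℕ< (s≤s i≤b))) (∈-allFin (fromℕ< (s≤s j≤b))))

  ∈-digitGrid⇒≤ : ∀ {y} → y ∈ digitGrid → y ≤ b + b * M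
  ∈-digitGrid⇒≤ y∈ with ∈-cartesianProductWith⁻ digit (allFin (suc b)) (allFin (suc b)) y∈
  ... | i , j , _ , _ , refl =
    +-mono-≤ (≤-pred (toℕ<n i)) (*-monoˡ-≤ M (≤-pred (toℕ<n j)))

  digitGrid-decompose : ∀ h {u v} → u ≤ h * b → v ≤ h * b →
    Σ (List ℕ) λ ys → length ys ≡ h × All (_∈ digitGrid) ys × sum ys ≡ u + v * M
  digitGrid-decompose zero    z≤n z≤n = [] , refl , [] , refl
  digitGrid-decompose (suc h) {u} {v} u≤ v≤
    with digitGrid-decompose h (m≤n+o⇒m∸n≤o u b u≤) (m≤n+o⇒m∸n≤o v b v≤)
  ... | ys , length≡h , ys∈ , sum≡ = (b ⊓ u + b ⊓ v * M) ∷ ys , cong suc length≡h ,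
    ∈-digitGrid⁺ (m⊓n≤m b u) (m⊓n≤m b v) ∷ ys∈ , (begin
      (b ⊓ u + b ⊓ v * M) + sum ys
        ≡⟨ cong (b ⊓ u + b ⊓ v * M +_) sum≡ ⟩
      (b ⊓ u + b ⊓ v * M) + ((u ∸ b) + (v ∸ b) * M)
        ≡⟨ digit-sum (b ⊓ u) (b ⊓ v) (u ∸ b) (v ∸ b) M ⟩
      (b ⊓ u + (u ∸ b)) + (b ⊓ v + (v ∸ b)) * M
        ≡⟨ cong₂ (λ p q → p + q * M) (m⊓n+n∸m≡n b u) (m⊓n+n∸m≡n b v) ⟩
      u + v * M ∎)
    where open ≡-Reasoning

module DigitGridSumset (b h : ℕ) where

  M : ℕ
  M = suc (h * b)

  open DigitGrid b M

  sumset≡interval : ∀ x → x ∈ map pos (upTo (M * M)) ⇔ x ∈Sumset h ⟨ map pos digitGrid ⟩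
  sumset≡interval x = mk⇔ to from
    where
    to : x ∈ map pos (upTo (M * M)) → x ∈Sumset h ⟨ map pos digitGrid ⟩
    to x∈ with ∈-map⁻ pos x∈
    ... | m , m∈ , refl with digitGrid-decompose h (≤-pred (m%n<n m M))
                               (≤-pred (m<n*o⇒m/o<n {m} {M} {M} (∈-upTo⁻ m∈)))
    ... | ys , length≡h , ys∈ , sum≡ = subst (_∈Sumset h ⟨ map pos digitGrid ⟩)
      (cong pos (trans sum≡ (sym (m≡m%n+[m/n]*n m M)))) (pos-sum∈Sumset ys length≡h ys∈)
    from : x ∈Sumset h ⟨ map pos digitGrid ⟩ → x ∈ map pos (upTo (M * M))
    from x∈hA with ∈Sumset-map-pos⁻ x∈hA
    ... | ys , refl , ys∈ , refl = ∈-map⁺ pos (∈-upTo⁺ (s≤s (begin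
      sum ys                              ≤⟨ sum≤length*bound ys (All.map ∈-digitGrid⇒≤ ys∈) ⟩
      length ys * (b + b * M)             ≡⟨ *-distribˡ-+ (length ys) b (b * M) ⟩
      length ys * b + length ys * (b * M) ≡⟨ cong (length ys * b +_) (*-assoc (length ys) b M) ⟨
      length ys * b + length ys * b * M   ∎)))
      where open ≤-Reasoning

  digitGrid-sumsetSize : .{{NonZero h}} → (M * M) ∈R[ h , suc b * suc b ]
  digitGrid-sumsetSize =
    map pos digitGrid ,
    Unique.map⁺ +-injective (digitGrid-unique (s≤s (m≤n*m b h))) ,
    trans (length-map pos digitGrid) length-digitGrid ,
    map pos (upTo (M * M)) ,
    Unique.map⁺ +-injective (Unique.upTo⁺ (M * M)) ,
    trans (length-map pos (upTo (M * M))) (length-upTo (M * M)) ,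
    sumset≡interval

m^2≡m*m : ∀ m → m ^ 2 ≡ m * m
m^2≡m*m m = cong (m *_) (*-identityʳ m)

mainTheorem5 : (h a : ℕ) → 1 ≤ h → 1 ≤ a →
    (((a ∸ 1) * h + 1) ^ 2) ∈R[ h , a ^ 2 ]
mainTheorem5 h (suc b) 1≤h _ = subst₂ (λ s k → s ∈R[ h , k ])
  (sym square≡M*M) (sym (m^2≡m*m (suc b)))
  (DigitGridSumset.digitGrid-sumsetSize b h {{>-nonZero 1≤h}})
  where
  open ≡-Reasoning
  square≡M*M : (b * h + 1) ^ 2 ≡ suc (h * b) * suc (h * b)
  square≡M*M = begin
    (b * h + 1) ^ 2           ≡⟨ cong (λ n → (n + 1) ^ 2) (*-comm b h) ⟩
    (h * b + 1) ^ 2           ≡⟨ cong (_^ 2) (+-comm (h * b) 1) ⟩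
    suc (h * b) ^ 2           ≡⟨ m^2≡m*m (suc (h * b)) ⟩
    suc (h * b) * suc (h * b) ∎
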